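{- Let $g\geq3$, let $m\geq1$ be an odd integer, and let $\Gamma=(\mathbb Z_m\times\mathbb Z_{4})\rtimes\mathbb Z_2$. Then an $RSM_\Gamma(\Gamma,g;[^{1}m,\ ^{8m-1}2])$ exists.
   Context: The generalized dihedral group $(\mathbb Z_m\times\mathbb Z_{4})\rtimes\mathbb Z_2$ has underlying set $(\mathbb Z_m\times\mathbb Z_{4})\times\mathbb Z_2$ and operation $(u,\tau)+(u',\tau')=(u+(-1)^\tau u',\tau+\tau')$. A list is a multiset; $[^{a}x,\ ^{b}y]$ has $a$ copies of $x$ and $b$ copies of $y$. For $S\subseteq\Gamma$, an $|S|$-list $\Sigma$ and $g\ge2$, a row-sum matrix $RSM_\Gamma(S,g;\Sigma)$ is an $|S|\times g$ matrix with entries in $\Gamma$ each of whose columns is a permutation of $S$, such that the multiset of left-to-right row sums is $\Sigma$. $RSM_\Gamma(S,g;L)$ with $L$ a list of positive integers means an $RSM_\Gamma(S,g;\Sigma)$ for some $\Sigma$ whose list of element orders equals $L$. -}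

module Defs where

open import Data.Nat using (ℕ; zero; suc; _+_; _*_; _∸_; _<_; NonZero)
open import Data.Nat.DivMod using (_mod_)
open import Data.Fin using (Fin; toℕ)
open import Data.Product using (_×_; _,_; Σ; ∃)
open import Data.List using (List; []; _∷_; foldl; replicate)
import Data.List as List
open import Data.List.Relation.Binary.Pointwise using (Pointwise)
open import Data.List.Relation.Binary.Permutation.Propositional using (_↭_)
open import Function.Definitions using (Bijective)
open import Relation.Binary.PropositionalEquality using (_≡_; _≢_)

_⊕_ : {n : ℕ} .{{_ : NonZero n}} → Fin n → Fin n → Fin n
_⊕_ {n} a b = (toℕ a + toℕ b) mod n

⊖_ : {n : ℕ} .{{_ : NonZero n}} → Fin n → Fin n
⊖_ {n} a = (n ∸ toℕ a) mod n

zeroF : {n : ℕ} .{{_ : NonZero n}} → Fin n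
zeroF {n} = 0 mod n

Γ : ℕ → Set
Γ m = (Fin m × Fin 4) × Fin 2

sgn : {m : ℕ} .{{_ : NonZero m}} → Fin 2 → Fin m × Fin 4 → Fin m × Fin 4
sgn Fin.zero u = u
sgn (Fin.suc _) (a , b) = (⊖ a , ⊖ b)

_·_ : {m : ℕ} .{{_ : NonZero m}} → Γ m → Γ m → Γ m
_·_ ((a , b) , τ) (u' , τ') with sgn τ u'
... | (a' , b') = ((a ⊕ a' , b ⊕ b') , τ ⊕ τ')

e : {m : ℕ} .{{_ : NonZero m}} → Γ m
e = ((zeroF , zeroF) , zeroF)

mul : {m : ℕ} .{{_ : NonZero m}} → ℕ → Γ m → Γ m
mul zero x = e
mul (suc n) x = mul n x · x

HasOrder : {m : ℕ} .{{_ : NonZero m}} → Γ m → ℕ → Set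
HasOrder x o = (0 < o) × (mul o x ≡ e) × (∀ j → 0 < j → j < o → mul j x ≢ e)

rowSum : {m g : ℕ} .{{_ : NonZero m}} → (Fin g → Γ m) → Γ m
rowSum {g = g} r = foldl _·_ e (List.tabulate r)

-- An RSM_Γ(Γ, g; L): an |Γ| × g matrix (|Γ| = 8m) each column a
-- permutation of Γ, whose list of row sums has list of element orders L
-- (up to reordering, i.e. as a multiset).
RSM-Γ : (m g : ℕ) .{{_ : NonZero m}} → List ℕ → Set
RSM-Γ m g L =
  Σ (Fin (8 * m) → Fin g → Γ m) λ M →
    (∀ j → Bijective _≡_ _≡_ (λ i → M i j)) ×
    ∃ λ (orders : List ℕ) →
      Pointwise HasOrder (List.tabulate (λ i → rowSum (M i))) orders ×
      (orders ↭ L)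

{-# OPTIONS --safe #-}
module Submission where

-- Index the rows by the elements x of Γ, write α = (1,0;0), β = (0,1;0), and call (u;1) a
-- reflection. For g = 3 take the columns x, σ₂(t x), σ₃ x and for g = 4 the columns
-- x, σ₂(t x), x, σ₄ x, where t exchanges e and β and the σᵢ are explicit permutations. The row of
-- e then sums to α, of order m, the row of β to β², of order 2, and every other row to a
-- reflection, which has order 2. Prepending two copies of the column x ↦ x · (0,0;1) preserves
-- these three properties, so the designs for 3 and 4 columns yield designs for every g ≥ 3.

open import Defs
open import Data.Nat using (ℕ; zero; suc; _+_; _*_; _∸_; _%_; _≤_; _<_; z≤n; s≤s; NonZero)
open import Data.Nat.Properties using (+-comm; +-assoc; m+[n∸m]≡n; <⇒≢)
open import Data.Nat.DivMod using (_mod_; %-distribˡ-+; m%n%n≡m%n; m<n⇒m%n≡m; n%n≡0; m*n%n≡0)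
open import Data.Fin using (Fin; zero; suc; toℕ)
open import Data.Fin.Patterns using (0F; 1F; 2F; 3F)
open import Data.Fin.Properties using (toℕ-fromℕ<; toℕ-injective; toℕ<n; toℕ≤n; 0≢1+n; *↔×)
import Data.Fin.Properties as Fin
open import Data.Product using (_×_; _,_; proj₁; proj₂; ∃)
open import Data.Product.Algebra using (×-comm; ×-assoc)
open import Data.Product.Function.NonDependent.Propositional using (_×-↔_)
open import Data.Product.Properties using (≡-dec)
open import Data.List using (List; []; _∷_; foldl; replicate; tabulate)
open import Data.List.Relation.Binary.Pointwise using (Pointwise; []; _∷_)
open import Data.List.Relation.Binary.Permutation.Propositional using (↭-refl)
open import Function.Bundles using (_↔_; Inverse; Bijection; mk↔ₛ′)
open import Function.Definitions using (Bijective)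
open import Function using (_∘_)
open import Function.Construct.Composition using (_↔-∘_)
open import Function.Construct.Identity using (↔-id)
open import Function.Construct.Symmetry using (↔-sym)
open import Function.Properties.Inverse using (Inverse⇒Bijection)
open import Relation.Binary.Definitions using (DecidableEquality)
open import Relation.Binary.PropositionalEquality
  using (_≡_; _≢_; refl; sym; trans; cong; cong₂; subst; module ≡-Reasoning)
open import Relation.Nullary using (yes; no; contradiction)

-- Arithmetic of ℤ_n

[m%n+k]%n≡[m+k]%n : ∀ m k n .{{_ : NonZero n}} → (m % n + k) % n ≡ (m + k) % n
[m%n+k]%n≡[m+k]%n m k n = begin
  (m % n + k) % n           ≡⟨ %-distribˡ-+ (m % n) k n ⟩
  (m % n % n + k % n) % n   ≡⟨ cong (λ a → (a + k % n) % n) (m%n%n≡m%n m n) ⟩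
  (m % n + k % n) % n       ≡⟨ %-distribˡ-+ m k n ⟨
  (m + k) % n               ∎
  where open ≡-Reasoning

[m+k%n]%n≡[m+k]%n : ∀ m k n .{{_ : NonZero n}} → (m + k % n) % n ≡ (m + k) % n
[m+k%n]%n≡[m+k]%n m k n = begin
  (m + k % n) % n   ≡⟨ cong (_% n) (+-comm m (k % n)) ⟩
  (k % n + m) % n   ≡⟨ [m%n+k]%n≡[m+k]%n k m n ⟩
  (k + m) % n       ≡⟨ cong (_% n) (+-comm k m) ⟩
  (m + k) % n       ∎
  where open ≡-Reasoning

module _ {n : ℕ} .{{_ : NonZero n}} where
  open ≡-Reasoning

  toℕ-⊕ : (a b : Fin n) → toℕ (a ⊕ b) ≡ (toℕ a + toℕ b) % n
  toℕ-⊕ a b = toℕ-fromℕ< _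

  toℕ-⊖ : (a : Fin n) → toℕ (⊖ a) ≡ (n ∸ toℕ a) % n
  toℕ-⊖ a = toℕ-fromℕ< _

  toℕ-zeroF : toℕ (zeroF {n}) ≡ 0
  toℕ-zeroF = trans (toℕ-fromℕ< _) (m*n%n≡0 0 n)

  toℕ-mod : ∀ i → toℕ (i mod n) ≡ i % n
  toℕ-mod i = toℕ-fromℕ< _

  ⊕-comm : (a b : Fin n) → a ⊕ b ≡ b ⊕ a
  ⊕-comm a b = toℕ-injective (begin
    toℕ (a ⊕ b)              ≡⟨ toℕ-⊕ a b ⟩
    (toℕ a + toℕ b) % n      ≡⟨ cong (_% n) (+-comm (toℕ a) (toℕ b)) ⟩
    (toℕ b + toℕ a) % n      ≡⟨ toℕ-⊕ b a ⟨
    toℕ (b ⊕ a)              ∎)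

  ⊕-assoc : (a b c : Fin n) → (a ⊕ b) ⊕ c ≡ a ⊕ (b ⊕ c)
  ⊕-assoc a b c = toℕ-injective (begin
    toℕ ((a ⊕ b) ⊕ c)                    ≡⟨ toℕ-⊕ (a ⊕ b) c ⟩
    (toℕ (a ⊕ b) + toℕ c) % n            ≡⟨ cong (λ x → (x + toℕ c) % n) (toℕ-⊕ a b) ⟩
    ((toℕ a + toℕ b) % n + toℕ c) % n    ≡⟨ [m%n+k]%n≡[m+k]%n (toℕ a + toℕ b) (toℕ c) n ⟩
    (toℕ a + toℕ b + toℕ c) % n          ≡⟨ cong (_% n) (+-assoc (toℕ a) (toℕ b) (toℕ c)) ⟩
    (toℕ a + (toℕ b + toℕ c)) % n        ≡⟨ [m+k%n]%n≡[m+k]%n (toℕ a) (toℕ b + toℕ c) n ⟨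
    (toℕ a + (toℕ b + toℕ c) % n) % n    ≡⟨ cong (λ x → (toℕ a + x) % n) (toℕ-⊕ b c) ⟨
    (toℕ a + toℕ (b ⊕ c)) % n            ≡⟨ toℕ-⊕ a (b ⊕ c) ⟨
    toℕ (a ⊕ (b ⊕ c))                    ∎)

  ⊕-identityˡ : (a : Fin n) → zeroF ⊕ a ≡ a
  ⊕-identityˡ a = toℕ-injective (begin
    toℕ (zeroF ⊕ a)               ≡⟨ toℕ-⊕ zeroF a ⟩
    (toℕ (zeroF {n}) + toℕ a) % n ≡⟨ cong (λ x → (x + toℕ a) % n) toℕ-zeroF ⟩
    toℕ a % n                     ≡⟨ m<n⇒m%n≡m (toℕ<n a) ⟩
    toℕ a                         ∎)

  ⊕-identityʳ : (a : Fin n) → a ⊕ zeroF ≡ a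
  ⊕-identityʳ a = trans (⊕-comm a zeroF) (⊕-identityˡ a)

  ⊕-inverseʳ : (a : Fin n) → a ⊕ (⊖ a) ≡ zeroF
  ⊕-inverseʳ a = toℕ-injective (begin
    toℕ (a ⊕ (⊖ a))                   ≡⟨ toℕ-⊕ a (⊖ a) ⟩
    (toℕ a + toℕ (⊖ a)) % n           ≡⟨ cong (λ x → (toℕ a + x) % n) (toℕ-⊖ a) ⟩
    (toℕ a + (n ∸ toℕ a) % n) % n     ≡⟨ [m+k%n]%n≡[m+k]%n (toℕ a) (n ∸ toℕ a) n ⟩
    (toℕ a + (n ∸ toℕ a)) % n         ≡⟨ cong (_% n) (m+[n∸m]≡n (toℕ≤n a)) ⟩
    n % n                             ≡⟨ n%n≡0 n ⟩
    0                                 ≡⟨ toℕ-zeroF ⟨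
    toℕ (zeroF {n})                   ∎)

  ⊕-inverseˡ : (a : Fin n) → (⊖ a) ⊕ a ≡ zeroF
  ⊕-inverseˡ a = trans (⊕-comm (⊖ a) a) (⊕-inverseʳ a)

  ⊖-zeroF : ⊖ zeroF ≡ zeroF {n}
  ⊖-zeroF = trans (sym (⊕-identityˡ (⊖ zeroF))) (⊕-inverseʳ zeroF)

  ⊕-⊖-zeroF : (a : Fin n) → a ⊕ (⊖ zeroF) ≡ a
  ⊕-⊖-zeroF a = trans (cong (a ⊕_) ⊖-zeroF) (⊕-identityʳ a)

  ⊕-⊖-cancelʳ : (a b : Fin n) → (a ⊕ b) ⊕ (⊖ b) ≡ a
  ⊕-⊖-cancelʳ a b = begin
    (a ⊕ b) ⊕ (⊖ b)     ≡⟨ ⊕-assoc a b (⊖ b) ⟩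
    a ⊕ (b ⊕ (⊖ b))     ≡⟨ cong (a ⊕_) (⊕-inverseʳ b) ⟩
    a ⊕ zeroF           ≡⟨ ⊕-identityʳ a ⟩
    a                   ∎

  ⊖-⊕-cancelʳ : (a b : Fin n) → (a ⊕ (⊖ b)) ⊕ b ≡ a
  ⊖-⊕-cancelʳ a b = begin
    (a ⊕ (⊖ b)) ⊕ b     ≡⟨ ⊕-assoc a (⊖ b) b ⟩
    a ⊕ ((⊖ b) ⊕ b)     ≡⟨ cong (a ⊕_) (⊕-inverseˡ b) ⟩
    a ⊕ zeroF           ≡⟨ ⊕-identityʳ a ⟩
    a                   ∎

  mod-⊕ : ∀ i j → (i mod n) ⊕ (j mod n) ≡ (i + j) mod n
  mod-⊕ i j = toℕ-injective (begin
    toℕ ((i mod n) ⊕ (j mod n))           ≡⟨ toℕ-⊕ (i mod n) (j mod n) ⟩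
    (toℕ (i mod n) + toℕ (j mod n)) % n
      ≡⟨ cong₂ (λ x y → (x + y) % n) (toℕ-mod i) (toℕ-mod j) ⟩
    (i % n + j % n) % n                   ≡⟨ %-distribˡ-+ i j n ⟨
    (i + j) % n                           ≡⟨ toℕ-mod (i + j) ⟨
    toℕ ((i + j) mod n)                   ∎)

Pointwise-tabulate-replicate : ∀ {A B : Set} {R : A → B → Set} {L} (f : Fin L → A) {b : B} →
  (∀ i → R (f i) b) → Pointwise R (tabulate f) (replicate L b)
Pointwise-tabulate-replicate {L = zero}  f Rf = []
Pointwise-tabulate-replicate {L = suc L} f Rf =
  Rf zero ∷ Pointwise-tabulate-replicate (λ i → f (suc i)) (λ i → Rf (suc i))

module Construction (n : ℕ) where
  open ≡-Reasoning

  N : ℕ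
  N = suc n

  one : Fin N
  one = 1 mod N

  α β β² : Γ N
  α  = ((one , 0F) , 0F)
  β  = ((0F , 1F) , 0F)
  β² = ((0F , 2F) , 0F)

  τ : Γ N → Fin 2
  τ = proj₂

  IsReflection : Γ N → Set
  IsReflection x = τ x ≡ 1F

  _≟_ : DecidableEquality (Γ N)
  _≟_ = ≡-dec (≡-dec Fin._≟_ Fin._≟_) Fin._≟_

  mul-α : ∀ j → mul j α ≡ ((j mod N , 0F) , 0F)
  mul-α zero    = refl
  mul-α (suc j) = begin
    mul j α · α                       ≡⟨ cong (_· α) (mul-α j) ⟩
    (((j mod N) ⊕ one , 0F) , 0F)     ≡⟨ cong (λ a → ((a , 0F) , 0F)) (mod-⊕ j 1) ⟩
    (((j + 1) mod N , 0F) , 0F)       ≡⟨ cong (λ i → ((i mod N , 0F) , 0F)) (+-comm j 1) ⟩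
    ((suc j mod N , 0F) , 0F)         ∎

  α-hasOrder : HasOrder α N
  α-hasOrder = s≤s z≤n , α^N≡e , α^j≢e
    where
      α^N≡e : mul N α ≡ e
      α^N≡e = trans (mul-α N) (cong (λ a → ((a , 0F) , 0F))
                (toℕ-injective (trans (toℕ-mod N) (n%n≡0 N))))
      α^j≢e : ∀ j → 0 < j → j < N → mul j α ≢ e
      α^j≢e j 0<j j<N α^j≡e = <⇒≢ 0<j (sym (begin
        j                  ≡⟨ m<n⇒m%n≡m j<N ⟨
        j % N              ≡⟨ toℕ-mod j ⟨
        toℕ (j mod N)      ≡⟨ cong (toℕ ∘ proj₁ ∘ proj₁) (trans (sym (mul-α j)) α^j≡e) ⟩
        0                  ∎))

  hasOrder-2 : ∀ {x : Γ N} → e · x ≢ e → (e · x) · x ≡ e → HasOrder x 2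
  hasOrder-2 x≢e x²≡e = s≤s z≤n , x²≡e , λ
    { 1 _ _ → x≢e
    ; (suc (suc _)) _ (s≤s (s≤s ()))
    }

  β²-hasOrder : HasOrder β² 2
  β²-hasOrder = hasOrder-2 (λ ()) refl

  ·-cancel-reflection : ∀ (y : Γ N) {r} → IsReflection r → (y · r) · r ≡ y
  ·-cancel-reflection ((c , d) , 0F) {(p , q) , 1F} refl =
    cong₂ (λ a b → ((a , b) , 0F)) (⊕-⊖-cancelʳ c p) (⊕-⊖-cancelʳ d q)
  ·-cancel-reflection ((c , d) , 1F) {(p , q) , 1F} refl =
    cong₂ (λ a b → ((a , b) , 1F)) (⊖-⊕-cancelʳ c p) (⊖-⊕-cancelʳ d q)

  reflection-hasOrder : ∀ {r : Γ N} → IsReflection r → HasOrder r 2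
  reflection-hasOrder {u , 1F} refl = hasOrder-2 (λ e·r≡e → 0≢1+n (sym (cong τ e·r≡e)))
                                                 (·-cancel-reflection e {u , 1F} refl)

  τ-·-twice : ∀ y w → τ ((y · w) · w) ≡ τ y
  τ-·-twice (_ , 0F) (_ , 0F) = refl
  τ-·-twice (_ , 0F) (_ , 1F) = refl
  τ-·-twice (_ , 1F) (_ , 0F) = refl
  τ-·-twice (_ , 1F) (_ , 1F) = refl

  τ-foldl-cong : ∀ {y y′} (ws : List (Γ N)) → τ y ≡ τ y′ →
                 τ (foldl _·_ y ws) ≡ τ (foldl _·_ y′ ws)
  τ-foldl-cong []       τy≡τy′ = τy≡τy′
  τ-foldl-cong (w ∷ ws) τy≡τy′ = τ-foldl-cong ws (cong (_⊕ τ w) τy≡τy′)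

  -- Permutations of Γ

  Permutation : Set
  Permutation = Γ N ↔ Γ N

  transpose-e-β : Γ N → Γ N
  transpose-e-β x with x ≟ e | x ≟ β
  ... | yes _ | _     = β
  ... | no _  | yes _ = e
  ... | no _  | no _  = x

  transpose-e-β-fixes : ∀ {x} → x ≢ e → x ≢ β → transpose-e-β x ≡ x
  transpose-e-β-fixes {x} x≢e x≢β with x ≟ e | x ≟ β
  ... | yes x≡e | _       = contradiction x≡e x≢e
  ... | no _    | yes x≡β = contradiction x≡β x≢β
  ... | no _    | no _    = refl

  transpose-e-β-involutive : ∀ x → transpose-e-β (transpose-e-β x) ≡ x
  transpose-e-β-involutive x with x ≟ e | x ≟ β
  ... | yes refl | _        = refl
  ... | no _     | yes refl = refl
  ... | no x≢e   | no x≢β   = transpose-e-β-fixes x≢e x≢β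

  transposition-e-β : Permutation
  transposition-e-β =
    mk↔ₛ′ transpose-e-β transpose-e-β transpose-e-β-involutive transpose-e-β-involutive

  τ-flip : Γ N → Γ N
  τ-flip (u , 0F) = (u , 1F)
  τ-flip (u , 1F) = (u , 0F)

  τ-flip-involutive : ∀ x → τ-flip (τ-flip x) ≡ x
  τ-flip-involutive (u , 0F) = refl
  τ-flip-involutive (u , 1F) = refl

  τ-flipping : Permutation
  τ-flipping = mk↔ₛ′ τ-flip τ-flip τ-flip-involutive τ-flip-involutive

  σ₂ σ₂⁻¹ σ₃ σ₃⁻¹ σ₄ σ₄⁻¹ : Γ N → Γ N
  σ₂ ((a , 0F) , 0F) = ((a , 0F) , 0F)
  σ₂ ((a , 1F) , 0F) = ((a ⊕ one , 0F) , 1F)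
  σ₂ ((a , 2F) , 0F) = ((a , 2F) , 0F)
  σ₂ ((a , 3F) , 0F) = ((a , 3F) , 1F)
  σ₂ ((a , 0F) , 1F) = ((a , 1F) , 0F)
  σ₂ ((a , 1F) , 1F) = ((a , 1F) , 1F)
  σ₂ ((a , 2F) , 1F) = ((a , 2F) , 1F)
  σ₂ ((a , 3F) , 1F) = ((a , 3F) , 0F)

  σ₂⁻¹ ((a , 0F) , 0F) = ((a , 0F) , 0F)
  σ₂⁻¹ ((a , 0F) , 1F) = ((a ⊕ (⊖ one) , 1F) , 0F)
  σ₂⁻¹ ((a , 2F) , 0F) = ((a , 2F) , 0F)
  σ₂⁻¹ ((a , 3F) , 1F) = ((a , 3F) , 0F)
  σ₂⁻¹ ((a , 1F) , 0F) = ((a , 0F) , 1F)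
  σ₂⁻¹ ((a , 1F) , 1F) = ((a , 1F) , 1F)
  σ₂⁻¹ ((a , 2F) , 1F) = ((a , 2F) , 1F)
  σ₂⁻¹ ((a , 3F) , 0F) = ((a , 3F) , 1F)

  σ₃ ((a , 0F) , 0F) = ((a , 0F) , 1F)
  σ₃ ((a , 1F) , 0F) = ((a , 1F) , 0F)
  σ₃ ((a , 2F) , 0F) = ((a , 2F) , 1F)
  σ₃ ((a , 3F) , 0F) = ((a , 3F) , 0F)
  σ₃ ((a , 0F) , 1F) = ((a , 0F) , 0F)
  σ₃ ((a , 1F) , 1F) = ((a , 1F) , 1F)
  σ₃ ((a , 2F) , 1F) = ((a , 3F) , 1F)
  σ₃ ((a , 3F) , 1F) = ((a , 2F) , 0F)

  σ₃⁻¹ ((a , 0F) , 1F) = ((a , 0F) , 0F)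
  σ₃⁻¹ ((a , 1F) , 0F) = ((a , 1F) , 0F)
  σ₃⁻¹ ((a , 2F) , 1F) = ((a , 2F) , 0F)
  σ₃⁻¹ ((a , 3F) , 0F) = ((a , 3F) , 0F)
  σ₃⁻¹ ((a , 0F) , 0F) = ((a , 0F) , 1F)
  σ₃⁻¹ ((a , 1F) , 1F) = ((a , 1F) , 1F)
  σ₃⁻¹ ((a , 3F) , 1F) = ((a , 2F) , 1F)
  σ₃⁻¹ ((a , 2F) , 0F) = ((a , 3F) , 1F)

  σ₄ ((a , 0F) , 0F) = ((a , 0F) , 1F)
  σ₄ ((a , 1F) , 0F) = ((a , 0F) , 0F)
  σ₄ ((a , 2F) , 0F) = ((a , 2F) , 1F)
  σ₄ ((a , 3F) , 0F) = ((a , 3F) , 0F)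
  σ₄ ((a , 0F) , 1F) = ((a , 1F) , 1F)
  σ₄ ((a , 1F) , 1F) = ((a , 1F) , 0F)
  σ₄ ((a , 2F) , 1F) = ((a , 2F) , 0F)
  σ₄ ((a , 3F) , 1F) = ((a , 3F) , 1F)

  σ₄⁻¹ ((a , 0F) , 1F) = ((a , 0F) , 0F)
  σ₄⁻¹ ((a , 0F) , 0F) = ((a , 1F) , 0F)
  σ₄⁻¹ ((a , 2F) , 1F) = ((a , 2F) , 0F)
  σ₄⁻¹ ((a , 3F) , 0F) = ((a , 3F) , 0F)
  σ₄⁻¹ ((a , 1F) , 1F) = ((a , 0F) , 1F)
  σ₄⁻¹ ((a , 1F) , 0F) = ((a , 1F) , 1F)
  σ₄⁻¹ ((a , 2F) , 0F) = ((a , 2F) , 1F)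
  σ₄⁻¹ ((a , 3F) , 1F) = ((a , 3F) , 1F)

  σ₂-σ₂⁻¹ : ∀ x → σ₂ (σ₂⁻¹ x) ≡ x
  σ₂-σ₂⁻¹ ((a , 0F) , 0F) = refl
  σ₂-σ₂⁻¹ ((a , 1F) , 0F) = refl
  σ₂-σ₂⁻¹ ((a , 2F) , 0F) = refl
  σ₂-σ₂⁻¹ ((a , 3F) , 0F) = refl
  σ₂-σ₂⁻¹ ((a , 0F) , 1F) = cong (λ b → ((b , 0F) , 1F)) (⊖-⊕-cancelʳ a one)
  σ₂-σ₂⁻¹ ((a , 1F) , 1F) = refl
  σ₂-σ₂⁻¹ ((a , 2F) , 1F) = refl
  σ₂-σ₂⁻¹ ((a , 3F) , 1F) = refl

  σ₂⁻¹-σ₂ : ∀ x → σ₂⁻¹ (σ₂ x) ≡ x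
  σ₂⁻¹-σ₂ ((a , 0F) , 0F) = refl
  σ₂⁻¹-σ₂ ((a , 1F) , 0F) = cong (λ b → ((b , 1F) , 0F)) (⊕-⊖-cancelʳ a one)
  σ₂⁻¹-σ₂ ((a , 2F) , 0F) = refl
  σ₂⁻¹-σ₂ ((a , 3F) , 0F) = refl
  σ₂⁻¹-σ₂ ((a , 0F) , 1F) = refl
  σ₂⁻¹-σ₂ ((a , 1F) , 1F) = refl
  σ₂⁻¹-σ₂ ((a , 2F) , 1F) = refl
  σ₂⁻¹-σ₂ ((a , 3F) , 1F) = refl

  σ₃-σ₃⁻¹ : ∀ x → σ₃ (σ₃⁻¹ x) ≡ x
  σ₃-σ₃⁻¹ ((_ , 0F) , 0F) = refl
  σ₃-σ₃⁻¹ ((_ , 1F) , 0F) = refl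
  σ₃-σ₃⁻¹ ((_ , 2F) , 0F) = refl
  σ₃-σ₃⁻¹ ((_ , 3F) , 0F) = refl
  σ₃-σ₃⁻¹ ((_ , 0F) , 1F) = refl
  σ₃-σ₃⁻¹ ((_ , 1F) , 1F) = refl
  σ₃-σ₃⁻¹ ((_ , 2F) , 1F) = refl
  σ₃-σ₃⁻¹ ((_ , 3F) , 1F) = refl

  σ₃⁻¹-σ₃ : ∀ x → σ₃⁻¹ (σ₃ x) ≡ x
  σ₃⁻¹-σ₃ ((_ , 0F) , 0F) = refl
  σ₃⁻¹-σ₃ ((_ , 1F) , 0F) = refl
  σ₃⁻¹-σ₃ ((_ , 2F) , 0F) = refl
  σ₃⁻¹-σ₃ ((_ , 3F) , 0F) = refl
  σ₃⁻¹-σ₃ ((_ , 0F) , 1F) = refl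
  σ₃⁻¹-σ₃ ((_ , 1F) , 1F) = refl
  σ₃⁻¹-σ₃ ((_ , 2F) , 1F) = refl
  σ₃⁻¹-σ₃ ((_ , 3F) , 1F) = refl

  σ₄-σ₄⁻¹ : ∀ x → σ₄ (σ₄⁻¹ x) ≡ x
  σ₄-σ₄⁻¹ ((_ , 0F) , 0F) = refl
  σ₄-σ₄⁻¹ ((_ , 1F) , 0F) = refl
  σ₄-σ₄⁻¹ ((_ , 2F) , 0F) = refl
  σ₄-σ₄⁻¹ ((_ , 3F) , 0F) = refl
  σ₄-σ₄⁻¹ ((_ , 0F) , 1F) = refl
  σ₄-σ₄⁻¹ ((_ , 1F) , 1F) = refl
  σ₄-σ₄⁻¹ ((_ , 2F) , 1F) = refl
  σ₄-σ₄⁻¹ ((_ , 3F) , 1F) = refl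

  σ₄⁻¹-σ₄ : ∀ x → σ₄⁻¹ (σ₄ x) ≡ x
  σ₄⁻¹-σ₄ ((_ , 0F) , 0F) = refl
  σ₄⁻¹-σ₄ ((_ , 1F) , 0F) = refl
  σ₄⁻¹-σ₄ ((_ , 2F) , 0F) = refl
  σ₄⁻¹-σ₄ ((_ , 3F) , 0F) = refl
  σ₄⁻¹-σ₄ ((_ , 0F) , 1F) = refl
  σ₄⁻¹-σ₄ ((_ , 1F) , 1F) = refl
  σ₄⁻¹-σ₄ ((_ , 2F) , 1F) = refl
  σ₄⁻¹-σ₄ ((_ , 3F) , 1F) = refl

  σ₂-permutation σ₃-permutation σ₄-permutation : Permutation
  σ₂-permutation = mk↔ₛ′ σ₂ σ₂⁻¹ σ₂-σ₂⁻¹ σ₂⁻¹-σ₂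
  σ₃-permutation = mk↔ₛ′ σ₃ σ₃⁻¹ σ₃-σ₃⁻¹ σ₃⁻¹-σ₃
  σ₄-permutation = mk↔ₛ′ σ₄ σ₄⁻¹ σ₄-σ₄⁻¹ σ₄⁻¹-σ₄

  σ₂-after-transposition : Permutation
  σ₂-after-transposition = σ₂-permutation ↔-∘ transposition-e-β

  -- Row designs

  sumAlong : ∀ {g} → (Fin g → Permutation) → Γ N → Γ N
  sumAlong columns x = rowSum (λ j → Inverse.to (columns j) x)

  record Design (g : ℕ) : Set where
    field
      columns        : Fin g → Permutation
      sum-e          : sumAlong columns e ≡ α
      sum-β          : sumAlong columns β ≡ β²
      sum-reflection : ∀ x → x ≢ e → x ≢ β → IsReflection (sumAlong columns x)

  τ-design₃ : ∀ x → IsReflection (((e · x) · σ₂ x) · σ₃ x)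
  τ-design₃ ((_ , 0F) , 0F) = refl
  τ-design₃ ((_ , 1F) , 0F) = refl
  τ-design₃ ((_ , 2F) , 0F) = refl
  τ-design₃ ((_ , 3F) , 0F) = refl
  τ-design₃ ((_ , 0F) , 1F) = refl
  τ-design₃ ((_ , 1F) , 1F) = refl
  τ-design₃ ((_ , 2F) , 1F) = refl
  τ-design₃ ((_ , 3F) , 1F) = refl

  τ-design₄ : ∀ x → IsReflection ((((e · x) · σ₂ x) · x) · σ₄ x)
  τ-design₄ ((_ , 0F) , 0F) = refl
  τ-design₄ ((_ , 1F) , 0F) = refl
  τ-design₄ ((_ , 2F) , 0F) = refl
  τ-design₄ ((_ , 3F) , 0F) = refl
  τ-design₄ ((_ , 0F) , 1F) = refl
  τ-design₄ ((_ , 1F) , 1F) = refl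
  τ-design₄ ((_ , 2F) , 1F) = refl
  τ-design₄ ((_ , 3F) , 1F) = refl

  [0⊕[0⊕1]]⊖0≡1 : (zeroF ⊕ (zeroF ⊕ one)) ⊕ (⊖ zeroF) ≡ one
  [0⊕[0⊕1]]⊖0≡1 = begin
    (zeroF ⊕ (zeroF ⊕ one)) ⊕ (⊖ zeroF)   ≡⟨ ⊕-⊖-zeroF _ ⟩
    zeroF ⊕ (zeroF ⊕ one)                 ≡⟨ ⊕-identityˡ _ ⟩
    zeroF ⊕ one                           ≡⟨ ⊕-identityˡ one ⟩
    one                                   ∎

  design₃ : Design 3
  design₃ = record
    { columns        = columns
    ; sum-e          = cong (λ a → ((a , 0F) , 0F)) [0⊕[0⊕1]]⊖0≡1
    ; sum-β          = refl
    ; sum-reflection = λ x x≢e x≢β → subst (λ y → IsReflection (((e · x) · σ₂ y) · σ₃ x))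
                                            (sym (transpose-e-β-fixes x≢e x≢β)) (τ-design₃ x)
    }
    where
      columns : Fin 3 → Permutation
      columns 0F = ↔-id _
      columns 1F = σ₂-after-transposition
      columns 2F = σ₃-permutation

  design₄ : Design 4
  design₄ = record
    { columns        = columns
    ; sum-e          = cong (λ a → ((a , 0F) , 0F)) (trans (⊕-⊖-zeroF _) [0⊕[0⊕1]]⊖0≡1)
    ; sum-β          = refl
    ; sum-reflection = λ x x≢e x≢β → subst (λ y → IsReflection ((((e · x) · σ₂ y) · x) · σ₄ x))
                                            (sym (transpose-e-β-fixes x≢e x≢β)) (τ-design₄ x)
    }
    where
      columns : Fin 4 → Permutation
      columns 0F = ↔-id _
      columns 1F = σ₂-after-transposition
      columns 2F = ↔-id _
      columns 3F = σ₄-permutation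

  -- τ-flip x = x · (0,0;1). For a rotation x this is a reflection, so the two prepended copies
  -- cancel; for any x they leave τ of the row sum unchanged.
  extend : ∀ {g} → Design g → Design (2 + g)
  extend {g} d = record
    { columns        = columns′
    ; sum-e          = trans (rotation-row-unchanged e refl) sum-e
    ; sum-β          = trans (rotation-row-unchanged β refl) sum-β
    ; sum-reflection = λ x x≢e x≢β →
        trans (τ-foldl-cong (row x) (τ-·-twice e (τ-flip x))) (sum-reflection x x≢e x≢β)
    }
    where
      open Design d
      columns′ : Fin (2 + g) → Permutation
      columns′ 0F            = τ-flipping
      columns′ 1F            = τ-flipping
      columns′ (suc (suc j)) = columns j
      row : Γ N → List (Γ N)
      row x = tabulate (λ j → Inverse.to (columns j) x)
      rotation-row-unchanged : ∀ x → IsReflection (τ-flip x) →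
                               sumAlong columns′ x ≡ sumAlong columns x
      rotation-row-unchanged x s =
        cong (λ y → foldl _·_ y (row x)) (·-cancel-reflection e {τ-flip x} s)

  design : ∀ k → Design (3 + k)
  design 0             = design₃
  design 1             = design₄
  design (suc (suc k)) = extend (design k)

  enumeration : Fin (8 * N) ↔ Γ N
  enumeration = ↔-sym (×-assoc _ (Fin N) (Fin 4) (Fin 2)) ↔-∘ (×-comm (Fin 4 × Fin 2) (Fin N)
                  ↔-∘ ((*↔× {4} {2} ×-↔ ↔-id (Fin N)) ↔-∘ *↔× {8} {N}))

  enumeration-suc≢e : ∀ i → Inverse.to enumeration (suc i) ≢ e
  enumeration-suc≢e i eq = 0≢1+n (sym (Bijection.injective (Inverse⇒Bijection enumeration) eq))

  design⇒RSM : ∀ {g} → Design g → RSM-Γ N g (N ∷ replicate (8 * N ∸ 1) 2)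
  design⇒RSM {g} d = M , columns-bijective , _ , orders , ↭-refl
    where
      open Design d
      M : Fin (8 * N) → Fin g → Γ N
      M i j = Inverse.to (columns j) (Inverse.to enumeration i)
      columns-bijective : ∀ j → Bijective _≡_ _≡_ (λ i → M i j)
      columns-bijective j = Bijection.bijective (Inverse⇒Bijection (columns j ↔-∘ enumeration))
      order-2 : ∀ x → x ≢ e → HasOrder (sumAlong columns x) 2
      order-2 x x≢e with x ≟ β
      ... | yes refl = subst (λ y → HasOrder y 2) (sym sum-β) β²-hasOrder
      ... | no x≢β   = reflection-hasOrder (sum-reflection x x≢e x≢β)
      -- The first row is the row of e: Inverse.to enumeration zero reduces to e.
      orders : Pointwise HasOrder (tabulate (λ i → rowSum (M i))) (N ∷ replicate (8 * N ∸ 1) 2)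
      orders = subst (λ y → HasOrder y N) (sym sum-e) α-hasOrder
             ∷ Pointwise-tabulate-replicate _ (λ i → order-2 _ (enumeration-suc≢e i))

-- The construction works for every m ≥ 1.
theorem3p7 : (g m : ℕ) .{{_ : NonZero m}} → 3 ≤ g → (∃ λ k → m ≡ suc (2 * k)) →
    RSM-Γ m g (m ∷ replicate (8 * m ∸ 1) 2)
theorem3p7 (suc (suc (suc k))) (suc n) (s≤s (s≤s (s≤s z≤n))) _ = design⇒RSM (design k)
  where open Construction n
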